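{- Let $X$ be a cubic $3$-regular graph and let $\alpha\in\mathrm{Aut}(X)$ be an involution fixing at least one vertex. Then every $\alpha$-rigid cell is an $I$-tree or a $Y$-tree. Moreover, if $X$ is not of type $\{3\}$ (i.e. $\mathrm{Aut}(X)$ contains a subgroup acting regularly on the $2$-arcs of $X$), then $\alpha$ does not have both an $I$-tree and a $Y$-tree among its rigid cells.
   Context: Graphs are finite, simple, connected. An $s$-arc is a sequence $(u_0,\dots,u_s)$ of distinct vertices with $u_i$ adjacent to $u_{i+1}$. A cubic graph $X$ is $s$-regular if $\mathrm{Aut}(X)$ acts regularly (transitively with trivial stabilizers) on its $s$-arcs; a subgroup is $s$-regular if it acts regularly on $s$-arcs. A cubic $3$-regular graph is of type $\{3\}$ if $\mathrm{Aut}(X)$ contains no arc-transitive subgroup other than itself, equivalently no $2$-regular subgroup. For an automorphism $\alpha$ with nonempty fixed-vertex set $\mathrm{Fix}(\alpha)$, the $\alpha$-rigid cells are the connected components of the subgraph induced on $\mathrm{Fix}(\alpha)$. An $I$-tree is a single edge; a $Y$-tree is the star $K_{1,3}$. -}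

module Defs where

open import Data.Nat using (ℕ; suc)
open import Data.Fin using (Fin; zero; suc; inject₁)
open import Data.Bool using (Bool; true)
open import Data.Product using (Σ; ∃; _×_; _,_)
open import Data.Sum using (_⊎_)
open import Data.Empty using (⊥)
open import Relation.Nullary using (¬_)
open import Relation.Binary.PropositionalEquality using (_≡_; _≢_)
open import Function using (_∘_; id)

record Graph : Set where
  field
    n      : ℕ
    adj    : Fin n → Fin n → Bool
    sym    : ∀ u v → adj u v ≡ true → adj v u ≡ true
    irrefl : ∀ v → ¬ (adj v v ≡ true)

module _ (X : Graph) where
  open Graph X

  V : Set
  V = Fin n

  E : V → V → Set
  E u v = adj u v ≡ true

  data Walk : V → V → Set where
    here : ∀ {v} → Walk v v
    step : ∀ {u v w} → E u v → Walk v w → Walk u w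

  Connected : Set
  Connected = ∀ u v → Walk u v

  Cubic : Set
  Cubic = ∀ v → Σ V λ a → Σ V λ b → Σ V λ c →
            a ≢ b × a ≢ c × b ≢ c ×
            (∀ w → E v w → (w ≡ a ⊎ w ≡ b ⊎ w ≡ c)) ×
            E v a × E v b × E v c

  record IsAut (f : V → V) : Set where
    field
      inv      : V → V
      inv-left  : ∀ v → inv (f v) ≡ v
      inv-right : ∀ v → f (inv v) ≡ v
      pres     : ∀ u v → E u v → E (f u) (f v)
      refl'    : ∀ u v → E (f u) (f v) → E u v

  Arc : ℕ → Set
  Arc s = Fin (suc s) → V

  IsArc : (s : ℕ) → Arc s → Set
  IsArc s a = (∀ i j → a i ≡ a j → i ≡ j) ×
              (∀ (i : Fin s) → E (a (inject₁ i)) (a (suc i)))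

  record IsSubgroup (G : (V → V) → Set) : Set where
    field
      sub   : ∀ f → G f → IsAut f
      hasId : G id
      comp  : ∀ f g → G f → G g → G (f ∘ g)
      inv   : ∀ f → G f → Σ (V → V) λ g → G g × (∀ v → g (f v) ≡ v)

  ActsRegularlyOnArcs : ((V → V) → Set) → ℕ → Set
  ActsRegularlyOnArcs G s =
    (∀ a b → IsArc s a → IsArc s b →
       Σ (V → V) λ f → G f × (∀ i → f (a i) ≡ b i)) ×
    (∀ f a → G f → IsArc s a → (∀ i → f (a i) ≡ a i) → ∀ v → f v ≡ v)

  SRegular : ℕ → Set
  SRegular s = ActsRegularlyOnArcs IsAut s

  -- X is NOT of type {3}: Aut(X) has a subgroup acting regularly on 2-arcs
  Has2RegularSubgroup : Set₁
  Has2RegularSubgroup =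
    Σ ((V → V) → Set) λ G → IsSubgroup G × ActsRegularlyOnArcs G 2

  IsInvolution : (V → V) → Set
  IsInvolution α = IsAut α × (∀ v → α (α v) ≡ v) × Σ V (λ v → α v ≢ v)

  Fix : (V → V) → V → Set
  Fix α v = α v ≡ v

  data FixReach (α : V → V) : V → V → Set where
    here : ∀ {v} → Fix α v → FixReach α v v
    step : ∀ {u v w} → Fix α u → E u v → FixReach α v w → FixReach α u w

  -- the α-rigid cell (component of ⟨Fix α⟩) containing a fixed vertex v
  Cell : (V → V) → V → V → Set
  Cell α v w = FixReach α v w

  IsITree : (V → Set) → Set
  IsITree C = Σ V λ a → Σ V λ b → a ≢ b × E a b ×
                (∀ w → C w → (w ≡ a ⊎ w ≡ b)) × C a × C b

  IsYTree : (V → Set) → Set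
  IsYTree C = Σ V λ c → Σ V λ x → Σ V λ y → Σ V λ z →
                c ≢ x × c ≢ y × c ≢ z × x ≢ y × x ≢ z × y ≢ z ×
                E c x × E c y × E c z ×
                ¬ E x y × ¬ E x z × ¬ E y z ×
                (∀ w → C w → (w ≡ c ⊎ w ≡ x ⊎ w ≡ y ⊎ w ≡ z)) ×
                C c × C x × C y × C z

-- A fixed vertex w of an involution α has 1 or 3 fixed neighbours, since α permutes the
-- three neighbours of w.  By 3-regularity no non-identity automorphism fixes a 3-arc, so
-- Fix α contains no 3-arc; a rigid cell is therefore an edge whose ends have no further fixed
-- neighbours (an I-tree) or a fixed vertex together with its three neighbours (a Y-tree).
-- If a 2-regular subgroup G exists and some cell is an I-tree ab, the element of G sending
-- the 2-arc (b, a, p) to (b, a, αp) agrees with α on a 3-arc, hence equals α.  So α ∈ G; but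
-- α fixes the 2-arc inside a Y-tree cell, and G has trivial 2-arc stabilisers.
module Submission where

open import Defs
open import Data.Empty using (⊥; ⊥-elim)
open import Data.Fin using (zero; suc; inject₁; _≟_)
open import Data.Product using (Σ; _×_; _,_; proj₁; proj₂)
open import Data.Sum using (_⊎_; inj₁; inj₂; swap; map₂; assocʳ)
open import Function using (_∘_; id)
open import Relation.Binary.PropositionalEquality
  using (_≡_; _≢_; _≗_; refl; sym; trans; cong; subst; subst₂; ≢-sym; module ≡-Reasoning)
open import Relation.Nullary using (¬_; yes; no)

module _ (X : Graph) where

  private
    _~_ : V X → V X → Set
    _~_ = E X

    variable
      a b c d p q s t u v w x y z : V X
      f g : V X → V X

  ~-sym : u ~ v → v ~ u
  ~-sym = Graph.sym X _ _

  ~⇒≢ : u ~ v → u ≢ v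
  ~⇒≢ u~u refl = Graph.irrefl X _ u~u

  path₂ : V X → V X → V X → Arc X 2
  path₂ a b c zero = a
  path₂ a b c (suc zero) = b
  path₂ a b c (suc (suc zero)) = c

  path₂-all : (P : V X → Set) → P a → P b → P c → ∀ i → P (path₂ a b c i)
  path₂-all P Pa Pb Pc zero = Pa
  path₂-all P Pa Pb Pc (suc zero) = Pb
  path₂-all P Pa Pb Pc (suc (suc zero)) = Pc

  path₂-isArc : a ≢ c → a ~ b → b ~ c → IsArc X 2 (path₂ a b c)
  path₂-isArc a≢c a~b b~c = injective , adjacent
    where
      a≢b = ~⇒≢ a~b
      b≢c = ~⇒≢ b~c
      injective : ∀ i j → path₂ _ _ _ i ≡ path₂ _ _ _ j → i ≡ j
      injective zero zero _ = refl
      injective zero (suc zero) e = ⊥-elim (a≢b e)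
      injective zero (suc (suc zero)) e = ⊥-elim (a≢c e)
      injective (suc zero) zero e = ⊥-elim (a≢b (sym e))
      injective (suc zero) (suc zero) _ = refl
      injective (suc zero) (suc (suc zero)) e = ⊥-elim (b≢c e)
      injective (suc (suc zero)) zero e = ⊥-elim (a≢c (sym e))
      injective (suc (suc zero)) (suc zero) e = ⊥-elim (b≢c (sym e))
      injective (suc (suc zero)) (suc (suc zero)) _ = refl
      adjacent : ∀ i → path₂ _ _ _ (inject₁ i) ~ path₂ _ _ _ (suc i)
      adjacent zero = a~b
      adjacent (suc zero) = b~c

  path₃ : V X → V X → V X → V X → Arc X 3
  path₃ a b c d zero = a
  path₃ a b c d (suc zero) = b
  path₃ a b c d (suc (suc zero)) = c
  path₃ a b c d (suc (suc (suc zero))) = d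

  path₃-all : (P : V X → Set) → P a → P b → P c → P d → ∀ i → P (path₃ a b c d i)
  path₃-all P Pa Pb Pc Pd zero = Pa
  path₃-all P Pa Pb Pc Pd (suc zero) = Pb
  path₃-all P Pa Pb Pc Pd (suc (suc zero)) = Pc
  path₃-all P Pa Pb Pc Pd (suc (suc (suc zero))) = Pd

  path₃-isArc : a ≢ c → a ≢ d → b ≢ d → a ~ b → b ~ c → c ~ d → IsArc X 3 (path₃ a b c d)
  path₃-isArc a≢c a≢d b≢d a~b b~c c~d = injective , adjacent
    where
      a≢b = ~⇒≢ a~b
      b≢c = ~⇒≢ b~c
      c≢d = ~⇒≢ c~d
      injective : ∀ i j → path₃ _ _ _ _ i ≡ path₃ _ _ _ _ j → i ≡ j
      injective zero zero _ = refl
      injective zero (suc zero) e = ⊥-elim (a≢b e)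
      injective zero (suc (suc zero)) e = ⊥-elim (a≢c e)
      injective zero (suc (suc (suc zero))) e = ⊥-elim (a≢d e)
      injective (suc zero) zero e = ⊥-elim (a≢b (sym e))
      injective (suc zero) (suc zero) _ = refl
      injective (suc zero) (suc (suc zero)) e = ⊥-elim (b≢c e)
      injective (suc zero) (suc (suc (suc zero))) e = ⊥-elim (b≢d e)
      injective (suc (suc zero)) zero e = ⊥-elim (a≢c (sym e))
      injective (suc (suc zero)) (suc zero) e = ⊥-elim (b≢c (sym e))
      injective (suc (suc zero)) (suc (suc zero)) _ = refl
      injective (suc (suc zero)) (suc (suc (suc zero))) e = ⊥-elim (c≢d e)
      injective (suc (suc (suc zero))) zero e = ⊥-elim (a≢d (sym e))
      injective (suc (suc (suc zero))) (suc zero) e = ⊥-elim (b≢d (sym e))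
      injective (suc (suc (suc zero))) (suc (suc zero)) e = ⊥-elim (c≢d (sym e))
      injective (suc (suc (suc zero))) (suc (suc (suc zero))) _ = refl
      adjacent : ∀ i → path₃ _ _ _ _ (inject₁ i) ~ path₃ _ _ _ _ (suc i)
      adjacent zero = a~b
      adjacent (suc zero) = b~c
      adjacent (suc (suc zero)) = c~d

  isAut-injective : IsAut X f → f u ≡ f v → u ≡ v
  isAut-injective {f = f} {u = u} {v = v} f-aut fu≡fv =
    trans (sym (inv-left u)) (trans (cong inv fu≡fv) (inv-left v))
    where open IsAut f-aut

  ∘-isAut : IsAut X f → IsAut X g → IsAut X (f ∘ g)
  ∘-isAut {f = f} {g = g} f-aut g-aut = record
    { inv = G.inv ∘ F.inv
    ; inv-left = λ v → trans (cong G.inv (F.inv-left (g v))) (G.inv-left v)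
    ; inv-right = λ v → trans (cong f (G.inv-right (F.inv v))) (F.inv-right v)
    ; pres = λ u v u~v → F.pres _ _ (G.pres u v u~v)
    ; refl' = λ u v e → G.refl' u v (F.refl' _ _ e) }
    where
      module F = IsAut f-aut
      module G = IsAut g-aut

  inverse-isAut : (f-aut : IsAut X f) → IsAut X (IsAut.inv f-aut)
  inverse-isAut {f = f} f-aut = record
    { inv = f
    ; inv-left = inv-right
    ; inv-right = inv-left
    ; pres = λ u v u~v → refl' _ _ (subst₂ _~_ (sym (inv-right u)) (sym (inv-right v)) u~v)
    ; refl' = λ u v e → subst₂ _~_ (inv-right u) (inv-right v) (pres _ _ e) }
    where open IsAut f-aut

  agree-on-arc⇒≗ : ∀ {s} {π : Arc X s} → SRegular X s → IsAut X f → IsAut X g →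
                   IsArc X s π → f ∘ π ≗ g ∘ π → f ≗ g
  agree-on-arc⇒≗ {f = f} {g = g} {π = π} (_ , stabiliser-trivial) f-aut g-aut π-arc f≗g-on-π v = begin
    f v                  ≡⟨ sym (inv-right (f v)) ⟩
    g (inv (f v))        ≡⟨ cong g (inv∘f≗id v) ⟩
    g v                  ∎
    where
      open IsAut g-aut
      open ≡-Reasoning
      inv∘f≗id : inv ∘ f ≗ id
      inv∘f≗id = stabiliser-trivial (inv ∘ f) π (∘-isAut (inverse-isAut g-aut) f-aut) π-arc
                   (λ i → trans (cong inv (f≗g-on-π i)) (inv-left (π i)))

  record Neighbourhood (w a b c : V X) : Set where
    constructor mkNeighbourhood
    field
      a≢b : a ≢ b
      a≢c : a ≢ c
      b≢c : b ≢ c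
      ⊆abc : ∀ t → w ~ t → t ≡ a ⊎ t ≡ b ⊎ t ≡ c
      w~a : w ~ a
      w~b : w ~ b
      w~c : w ~ c

  open Neighbourhood

  rotate : Neighbourhood w a b c → Neighbourhood w b c a
  rotate N = mkNeighbourhood (b≢c N) (≢-sym (a≢b N)) (≢-sym (a≢c N))
    (λ t w~t → assocʳ (swap (⊆abc N t w~t))) (w~b N) (w~c N) (w~a N)

  swap₂₃ : Neighbourhood w a b c → Neighbourhood w a c b
  swap₂₃ N = mkNeighbourhood (a≢c N) (a≢b N) (≢-sym (b≢c N))
    (λ t w~t → map₂ swap (⊆abc N t w~t)) (w~a N) (w~c N) (w~b N)

  cubic-neighbourhood : Cubic X → ∀ w → Σ (V X) λ a → Σ (V X) λ b → Σ (V X) λ c → Neighbourhood w a b c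
  cubic-neighbourhood cubic w with cubic w
  ... | a , b , c , a≢b , a≢c , b≢c , ⊆abc , w~a , w~b , w~c =
    a , b , c , mkNeighbourhood a≢b a≢c b≢c ⊆abc w~a w~b w~c

  neighbourhood : Cubic X → w ~ u → Σ (V X) λ p → Σ (V X) λ q → Neighbourhood w u p q
  neighbourhood {w = w} cubic w~u with cubic-neighbourhood cubic w
  ... | a , b , c , N with ⊆abc N _ w~u
  ...   | inj₁ refl = b , c , N
  ...   | inj₂ (inj₁ refl) = c , a , rotate N
  ...   | inj₂ (inj₂ refl) = a , b , rotate (rotate N)

  neighbourhood-avoiding : Neighbourhood w u p q → ∀ x →
                           Σ (V X) λ p′ → Σ (V X) λ q′ → Neighbourhood w u p′ q′ × p′ ≢ x
  neighbourhood-avoiding {p = p} {q = q} N x with p ≟ x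
  ... | no p≢x = p , q , N , p≢x
  ... | yes refl = q , p , swap₂₃ N , ≢-sym (b≢c N)

  module _ {α : V X → V X} where

    fixReach-source : FixReach X α s t → Fix X α s
    fixReach-source (here fs) = fs
    fixReach-source (step fs _ _) = fs

    fixReach-target : FixReach X α s t → Fix X α t
    fixReach-target (here ft) = ft
    fixReach-target (step _ _ r) = fixReach-target r

    fixReach-trans : FixReach X α s t → FixReach X α t u → FixReach X α s u
    fixReach-trans (here _) r = r
    fixReach-trans (step fs s~ r) r′ = step fs s~ (fixReach-trans r r′)

    fixReach-edge : Fix X α s → s ~ t → Fix X α t → FixReach X α s t
    fixReach-edge fs s~t ft = step fs s~t (here ft)

    fixReach-sym : FixReach X α s t → FixReach X α t s
    fixReach-sym (here fs) = here fs
    fixReach-sym (step fs s~ r) =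
      fixReach-trans (fixReach-sym r) (fixReach-edge (fixReach-source r) (~-sym s~) fs)

    fixReach-closed : (S : V X → Set) → (∀ {t w} → S t → Fix X α w → t ~ w → S w) →
                      S s → FixReach X α s t → S t
    fixReach-closed S closed Ss (here _) = Ss
    fixReach-closed S closed Ss (step _ s~ r) =
      fixReach-closed S closed (closed Ss (fixReach-source r) s~) r

  SoleFixedNeighbour : (V X → V X) → V X → V X → Set
  SoleFixedNeighbour α w u = ∀ {t} → Fix X α t → w ~ t → t ≡ u

  unfixed-others⇒sole : ∀ {α} → Neighbourhood w u p q → ¬ Fix X α p → ¬ Fix X α q →
                        SoleFixedNeighbour α w u
  unfixed-others⇒sole N ¬fp ¬fq {t} ft w~t with ⊆abc N t w~t
  ... | inj₁ t≡u = t≡u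
  ... | inj₂ (inj₁ refl) = ⊥-elim (¬fp ft)
  ... | inj₂ (inj₂ refl) = ⊥-elim (¬fq ft)

  I-cell : ∀ {α} → Fix X α v → Fix X α a → v ~ a →
           SoleFixedNeighbour α v a → SoleFixedNeighbour α a v →
           FixReach X α s v → IsITree X (Cell X α s)
  I-cell {v = v} {a = a} {s = s} {α = α} fv fa v~a sole-v sole-a s→v =
    v , a , ~⇒≢ v~a , v~a , bounded , s→v , fixReach-trans s→v (fixReach-edge fv v~a fa)
    where
      S : V X → Set
      S t = t ≡ v ⊎ t ≡ a
      closed : ∀ {t w} → S t → Fix X α w → t ~ w → S w
      closed (inj₁ refl) fw t~w = inj₂ (sole-v fw t~w)
      closed (inj₂ refl) fw t~w = inj₁ (sole-a fw t~w)
      bounded : ∀ w → Cell X α s w → S w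
      bounded w s→w = fixReach-closed S closed (inj₁ refl) (fixReach-trans (fixReach-sym s→v) s→w)

  two-vertex-cell-sole : ∀ {α} → (∀ t → Cell X α v t → t ≡ a ⊎ t ≡ b) → FixReach X α v a →
                         SoleFixedNeighbour α a b
  two-vertex-cell-sole bounded v→a {t} ft a~t
    with bounded t (fixReach-trans v→a (fixReach-edge (fixReach-target v→a) a~t ft))
  ... | inj₁ refl = ⊥-elim (~⇒≢ a~t refl)
  ... | inj₂ t≡b = t≡b

  module _ {α : V X → V X} (α-aut : IsAut X α) where

    fixed-~-image : Fix X α w → w ~ t → w ~ α t
    fixed-~-image {w = w} {t = t} fw w~t = subst (_~ α t) fw (IsAut.pres α-aut w t w~t)

    image-of-other : Fix X α w → Fix X α u → Neighbourhood w u p q → α p ≡ p ⊎ α p ≡ q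
    image-of-other fw fu N with ⊆abc N _ (fixed-~-image fw (w~b N))
    ... | inj₁ αp≡u = ⊥-elim (a≢b N (sym (isAut-injective α-aut (trans αp≡u (sym fu)))))
    ... | inj₂ αp = αp

    others-fixed-or-unfixed : Fix X α w → Fix X α u → Neighbourhood w u p q →
                              (Fix X α p × Fix X α q) ⊎ (¬ Fix X α p × ¬ Fix X α q)
    others-fixed-or-unfixed fw fu N
      with image-of-other fw fu N | image-of-other fw fu (swap₂₃ N)
    ... | inj₁ fp | inj₁ fq = inj₁ (fp , fq)
    ... | inj₁ fp | inj₂ αq≡p = ⊥-elim (b≢c N (isAut-injective α-aut (trans fp (sym αq≡p))))
    ... | inj₂ αp≡q | inj₁ fq = ⊥-elim (b≢c N (isAut-injective α-aut (trans αp≡q (sym fq))))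
    ... | inj₂ αp≡q | inj₂ αq≡p =
      inj₂ ((λ fp → b≢c N (trans (sym fp) αp≡q)) , (λ fq → b≢c N (trans (sym αq≡p) fq)))

    unfixed-other-swapped : Fix X α w → Fix X α u → Neighbourhood w u p q → ¬ Fix X α p → α p ≡ q
    unfixed-other-swapped fw fu N ¬fp with image-of-other fw fu N
    ... | inj₁ fp = ⊥-elim (¬fp fp)
    ... | inj₂ αp≡q = αp≡q

    module _ (α-involutive : ∀ v → α (α v) ≡ v) where

      third-fixed : Fix X α w → Neighbourhood w a p q → α a ≡ p → Fix X α q
      third-fixed fw N αa≡p with ⊆abc N _ (fixed-~-image fw (w~c N))
      ... | inj₁ αq≡a = ⊥-elim (b≢c N (isAut-injective α-aut αp≡αq))
        where αp≡αq = trans (trans (cong α (sym αa≡p)) (α-involutive _)) (sym αq≡a)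
      ... | inj₂ (inj₁ αq≡p) = ⊥-elim (a≢c N (isAut-injective α-aut (trans αa≡p (sym αq≡p))))
      ... | inj₂ (inj₂ fq) = fq

      fixed-neighbour : Cubic X → Fix X α w → Σ (V X) λ u → Fix X α u × w ~ u
      fixed-neighbour {w = w} cubic fw with cubic-neighbourhood cubic w
      ... | a , p , q , N with ⊆abc N _ (fixed-~-image fw (w~a N))
      ...   | inj₁ fa = a , fa , w~a N
      ...   | inj₂ (inj₁ αa≡p) = q , third-fixed fw N αa≡p , w~c N
      ...   | inj₂ (inj₂ αa≡q) = p , third-fixed fw (swap₂₃ N) αa≡q , w~b N

    module _ (reg : SRegular X 3) (moved : Σ (V X) λ m → α m ≢ m) where

      no-fixed-3-arc : Fix X α a → Fix X α b → Fix X α c → Fix X α d →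
                       a ≢ c → a ≢ d → b ≢ d → a ~ b → b ~ c → c ~ d → ⊥
      no-fixed-3-arc fa fb fc fd a≢c a≢d b≢d a~b b~c c~d =
        proj₂ moved (proj₂ reg α _ α-aut (path₃-isArc a≢c a≢d b≢d a~b b~c c~d)
                      (path₃-all (Fix X α) fa fb fc fd) (proj₁ moved))

      leaf-sole : Neighbourhood c x y z → Fix X α c → Fix X α x → Fix X α y → Fix X α z →
                  SoleFixedNeighbour α x c
      leaf-sole {c = c} {x = x} {y = y} {z = z} N fc fx fy fz {w} fw x~w with w ≟ c | w ≟ y
      ... | yes w≡c | _ = w≡c
      ... | no w≢c | yes refl =
        ⊥-elim (no-fixed-3-arc fw fx fc fz w≢c (b≢c N) (a≢c N) (~-sym x~w) (~-sym (w~a N)) (w~c N))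
      ... | no w≢c | no w≢y =
        ⊥-elim (no-fixed-3-arc fw fx fc fy w≢c w≢y (a≢b N) (~-sym x~w) (~-sym (w~a N)) (w~b N))

      Y-cell : Neighbourhood c x y z → Fix X α c → Fix X α x → Fix X α y → Fix X α z →
               FixReach X α s c → IsYTree X (Cell X α s)
      Y-cell {c = c} {x = x} {y = y} {z = z} {s = s} N fc fx fy fz s→c =
        c , x , y , z , ~⇒≢ (w~a N) , ~⇒≢ (w~b N) , ~⇒≢ (w~c N) , a≢b N , a≢c N , b≢c N ,
        w~a N , w~b N , w~c N ,
        (λ x~y → ~⇒≢ (w~b N) (sym (sole-x fy x~y))) ,
        (λ x~z → ~⇒≢ (w~c N) (sym (sole-x fz x~z))) ,
        (λ y~z → ~⇒≢ (w~c N) (sym (sole-y fz y~z))) ,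
        bounded , s→c , reach fx (w~a N) , reach fy (w~b N) , reach fz (w~c N)
        where
          sole-x = leaf-sole N fc fx fy fz
          sole-y = leaf-sole (rotate N) fc fy fz fx
          sole-z = leaf-sole (rotate (rotate N)) fc fz fx fy
          reach : ∀ {t} → Fix X α t → c ~ t → FixReach X α s t
          reach ft c~t = fixReach-trans s→c (fixReach-edge fc c~t ft)
          S : V X → Set
          S t = t ≡ c ⊎ t ≡ x ⊎ t ≡ y ⊎ t ≡ z
          closed : ∀ {t w} → S t → Fix X α w → t ~ w → S w
          closed (inj₁ refl) fw t~w = inj₂ (⊆abc N _ t~w)
          closed (inj₂ (inj₁ refl)) fw t~w = inj₁ (sole-x fw t~w)
          closed (inj₂ (inj₂ (inj₁ refl))) fw t~w = inj₁ (sole-y fw t~w)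
          closed (inj₂ (inj₂ (inj₂ refl))) fw t~w = inj₁ (sole-z fw t~w)
          bounded : ∀ w → Cell X α s w → S w
          bounded w s→w = fixReach-closed S closed (inj₁ refl) (fixReach-trans (fixReach-sym s→c) s→w)

      rigid-cell-I-or-Y : (α-involutive : ∀ v → α (α v) ≡ v) → Cubic X → Fix X α v →
                          IsITree X (Cell X α v) ⊎ IsYTree X (Cell X α v)
      rigid-cell-I-or-Y α-involutive cubic fv with fixed-neighbour α-involutive cubic fv
      ... | a , fa , v~a with neighbourhood cubic v~a | neighbourhood cubic (~-sym v~a)
      ... | p , q , Nv | r , r′ , Na with others-fixed-or-unfixed fv fa Nv | others-fixed-or-unfixed fa fv Na
      ... | inj₁ (fp , fq) | _ = inj₂ (Y-cell Nv fv fa fp fq (here fv))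
      ... | inj₂ _ | inj₁ (fr , fr′) = inj₂ (Y-cell Na fa fv fr fr′ (fixReach-edge fv v~a fa))
      ... | inj₂ (¬fp , ¬fq) | inj₂ (¬fr , ¬fr′) =
        inj₁ (I-cell fv fa v~a (unfixed-others⇒sole Nv ¬fp ¬fq) (unfixed-others⇒sole Na ¬fr ¬fr′) (here fv))

  module _ (G : (V X → V X) → Set) (G⊆Aut : ∀ g → G g → IsAut X g)
           (G-2-regular : ActsRegularlyOnArcs X G 2) where

    fixing-edge-swaps-others : G g → g a ≡ a → g b ≡ b → Neighbourhood b a p q → g x ≢ x → g p ≡ q
    fixing-edge-swaps-others {g = g} Gg ga gb N gx≢x
      with ⊆abc N _ (subst (_~ g _) gb (IsAut.pres (G⊆Aut g Gg) _ _ (w~b N)))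
    ... | inj₁ gp≡a = ⊥-elim (a≢b N (sym (isAut-injective (G⊆Aut g Gg) (trans gp≡a (sym ga)))))
    ... | inj₂ (inj₁ gp≡p) =
      ⊥-elim (gx≢x (proj₂ G-2-regular g _ Gg (path₂-isArc (a≢b N) (~-sym (w~a N)) (w~b N))
                      (path₂-all (λ v → g v ≡ v) ga gb gp≡p) _))
    ... | inj₂ (inj₂ gp≡q) = gp≡q

    -- p′ is chosen ≠ p so that (p, a, b, p′) is a 3-arc even when ab lies on a triangle.
    isolated-fixed-edge⇒∈G : ∀ {α} → Cubic X → SRegular X 3 → IsAut X α →
                             Fix X α a → Fix X α b → a ~ b →
                             SoleFixedNeighbour α a b → SoleFixedNeighbour α b a →
                             Σ (V X → V X) λ σ → G σ × σ ≗ α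
    isolated-fixed-edge⇒∈G {a = a} {b = b} {α = α} cubic reg α-aut fa fb a~b sole-a sole-b
      with neighbourhood cubic a~b | neighbourhood cubic (~-sym a~b)
    ... | p , q , Na | _ , _ , Nb₀ with neighbourhood-avoiding Nb₀ p
    ... | p′ , q′ , Nb , p′≢p = σ , Gσ , σ≗α
      where
        αp≡q : α p ≡ q
        αp≡q = unfixed-other-swapped α-aut fa fb Na (λ fp → a≢b Na (sym (sole-a fp (w~b Na))))
        αp′≡q′ : α p′ ≡ q′
        αp′≡q′ = unfixed-other-swapped α-aut fb fa Nb (λ fp′ → a≢b Nb (sym (sole-b fp′ (w~b Nb))))
        transported = proj₁ G-2-regular (path₂ b a p) (path₂ b a q)
                        (path₂-isArc (a≢b Na) (~-sym a~b) (w~b Na))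
                        (path₂-isArc (a≢c Na) (~-sym a~b) (w~c Na))
        σ = proj₁ transported
        Gσ = proj₁ (proj₂ transported)
        σb : σ b ≡ b
        σb = proj₂ (proj₂ transported) zero
        σa : σ a ≡ a
        σa = proj₂ (proj₂ transported) (suc zero)
        σp : σ p ≡ q
        σp = proj₂ (proj₂ transported) (suc (suc zero))
        σp′ : σ p′ ≡ q′
        σp′ = fixing-edge-swaps-others Gσ σa σb Nb (λ σp≡p → b≢c Na (trans (sym σp≡p) σp))
        σ≗α : σ ≗ α
        σ≗α = agree-on-arc⇒≗ reg (G⊆Aut σ Gσ) α-aut
                (path₃-isArc (≢-sym (a≢b Na)) (≢-sym p′≢p) (a≢b Nb) (~-sym (w~b Na)) a~b (w~b Nb))
                (path₃-all (λ v → σ v ≡ α v) (trans σp (sym αp≡q)) (trans σa (sym fa))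
                   (trans σb (sym fb)) (trans σp′ (sym αp′≡q′)))

    no-I-and-Y-cells : ∀ {α} → Cubic X → SRegular X 3 → IsAut X α → Σ (V X) (λ m → α m ≢ m) →
                       IsITree X (Cell X α v) → IsYTree X (Cell X α w) → ⊥
    no-I-and-Y-cells {α = α} cubic reg α-aut (m , αm≢m)
      (a , b , _ , a~b , I-bounded , v→a , v→b)
      (c , x , y , _ , _ , _ , _ , x≢y , _ , _ , c~x , c~y , _ , _ , _ , _ , _ , w→c , w→x , w→y , _) =
      αm≢m (trans (sym (σ≗α m)) (σ≗id m))
      where
        α-in-G = isolated-fixed-edge⇒∈G cubic reg α-aut (fixReach-target v→a) (fixReach-target v→b) a~b
                   (two-vertex-cell-sole I-bounded v→a)
                   (two-vertex-cell-sole (λ t → swap ∘ I-bounded t) v→b)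
        σ = proj₁ α-in-G
        σ≗α = proj₂ (proj₂ α-in-G)
        fixed : Fix X α t → σ t ≡ t
        fixed ft = trans (σ≗α _) ft
        σ≗id : σ ≗ id
        σ≗id = proj₂ G-2-regular σ _ (proj₁ (proj₂ α-in-G)) (path₂-isArc x≢y (~-sym c~x) c~y)
                 (path₂-all (λ v → σ v ≡ v) (fixed (fixReach-target w→x)) (fixed (fixReach-target w→c))
                    (fixed (fixReach-target w→y)))

proposition3p3 : (X : Graph) → Connected X → Cubic X → SRegular X 3 →
    (α : V X → V X) → IsInvolution X α → Σ (V X) (Fix X α) →
    ((v : V X) → Fix X α v → IsITree X (Cell X α v) ⊎ IsYTree X (Cell X α v)) ×
    (Has2RegularSubgroup X →
      ¬ (Σ (V X) λ v → Σ (V X) λ w → Fix X α v × Fix X α w ×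
           IsITree X (Cell X α v) × IsYTree X (Cell X α w)))
proposition3p3 X _ cubic reg α (α-aut , α-involutive , moved) _ =
  (λ v fv → rigid-cell-I-or-Y X α-aut reg moved α-involutive cubic fv) ,
  λ { (G , G-subgroup , G-2-regular) (_ , _ , _ , _ , I , Y) →
        no-I-and-Y-cells X G (IsSubgroup.sub G-subgroup) G-2-regular cubic reg α-aut moved I Y }
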